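{- Let $T$ be a permutation tableau. Then $\mathrm{inv}(T)=0$ if and only if $T$ is an L-Bell tableau, i.e. every topmost $1$ of $T$ (the topmost $1$ of some column) is also the leftmost $1$ in its row.
   Context: A permutation tableau of length $n$ is a Ferrers diagram (left-justified rows of weakly decreasing length from top to bottom; rows of length $0$ are allowed, and every column is nonempty) whose cells are filled with $0$'s and $1$'s such that (i) each column contains at least one $1$, and (ii) there is no $0$ that has a $1$ above it in its column and a $1$ to its left in its row. The boundary path from the top-right corner to the bottom-left corner consists of $n$ unit steps labeled $1,\ldots,n$ in order; a vertical step gives its row its label, a horizontal step gives its column its label. $(i,j)$ is the cell in row labeled $i$ and column labeled $j$. A larger row label means a lower row; a larger column label means a column further left. A $0$ is restricted if there is a $1$ above it in its column. A row is unrestricted if it contains no restricted $0$. The topmost $1$ of each column is a black dot, labeled by its column label; in each row containing a restricted $0$, the rightmost restricted $0$ is a white dot, labeled by its row label. The alternating path starting at a dot $d$ is the sequence of dots $d=d_1,d_2,\ldots$ with: if $d_m$ is a white dot in column $j$, $d_{m+1}$ is the black dot of column $j$; if $d_m$ is a black dot in a row $i$ that is not unrestricted, $d_{m+1}$ is the white dot of row $i$; if $d_m$ is a black dot in an unrestricted row, the path ends. $P_k$ is the path starting at the dot labeled $k$. A path $P$ contains $Q$ if $Q$ is a (final) segment of $P$. Order: for paths $P,Q$ neither containing the other: if they have no common dot, $P>Q$ if the ending dot of $P$ is in a lower row than that of $Q$, or in the same row and to the right of it, and $P<Q$ otherwise. If they share a dot, they coincide from the first common dot on; deleting the common dots gives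 $P',Q'$, and $P>Q$ if the ending dot of $P'$ is below or to the right of the ending dot of $Q'$, and $P<Q$ otherwise. Inversions: for a column label $j$ and a label $k>j$ of a dot such that $k$ is not the label of a dot on $P_j$, $(j,k)$ is an inversion of $T$ if $P_j>P_k$; $\mathrm{inv}(T)$ is the number of inversions of $T$. -}

module Defs where

open import Data.Nat using (ℕ)
open import Data.Bool using (Bool; true; false)
open import Data.Fin using (Fin; _<_; _≟_)
open import Data.List using (List; []; _∷_; _++_; [_]; filter)
open import Data.List.Membership.Propositional using (_∈_; _∉_)
import Data.List.Membership.DecPropositional as DecMem
open import Data.Product using (_×_; _,_; ∃; ∃₂)
open import Data.Sum using (_⊎_)
open import Relation.Nullary using (¬_; ¬?)
open import Relation.Binary.PropositionalEquality using (_≡_)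

-- A step of the boundary path (from the top-right to the bottom-left corner):
-- V = vertical step (its label is a row label), H = horizontal step (column label).
data Step : Set where
  V H : Step

-- Labels 1..n are represented by Fin n (label ℓ ↦ ℓ-1); the order is preserved.
-- The shape is determined by the boundary path; the filling is a 0/1 function,
-- only its values on cells of the diagram are relevant.
record Filling (n : ℕ) : Set where
  field
    step : Fin n → Step
    fill : Fin n → Fin n → Bool

module _ {n : ℕ} (T : Filling n) where
  open Filling T
  open DecMem (_≟_ {n}) using (_∈?_)

  IsRow : Fin n → Set
  IsRow i = step i ≡ V

  IsCol : Fin n → Set
  IsCol j = step j ≡ H

  Cell : Fin n → Fin n → Set
  Cell i j = IsRow i × IsCol j × i < j

  One : Fin n → Fin n → Set
  One i j = fill i j ≡ true

  Zero : Fin n → Fin n → Set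
  Zero i j = fill i j ≡ false

  -- a 1 above (i , j) in column j  (rows above have smaller labels)
  OneAbove : Fin n → Fin n → Set
  OneAbove i j = ∃ λ i′ → i′ < i × IsRow i′ × One i′ j

  -- a 1 to the left of (i , j) in row i  (columns to the left have larger labels)
  OneLeft : Fin n → Fin n → Set
  OneLeft i j = ∃ λ j′ → j < j′ × IsCol j′ × One i j′

  IsPermTableau : Set
  IsPermTableau =
    (∀ j → IsCol j → ∃ λ i → Cell i j × One i j)
    × (∀ i j → Cell i j → Zero i j → ¬ (OneAbove i j × OneLeft i j))

  RestrictedZero : Fin n → Fin n → Set
  RestrictedZero i j = Cell i j × Zero i j × OneAbove i j

  Unrestricted : Fin n → Set
  Unrestricted i = IsRow i × (∀ j → ¬ RestrictedZero i j)

  BlackDot : Fin n → Fin n → Set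
  BlackDot i j = Cell i j × One i j × (∀ i′ → i′ < i → IsRow i′ → Zero i′ j)

  -- rightmost restricted 0 of row i (columns to the right have smaller labels)
  WhiteDot : Fin n → Fin n → Set
  WhiteDot i j = RestrictedZero i j × (∀ j′ → j′ < j → ¬ RestrictedZero i j′)

  DotAt : Fin n → Fin n → Fin n → Set
  DotAt k i j = (IsCol k × j ≡ k × BlackDot i j) ⊎ (IsRow k × i ≡ k × WhiteDot i j)

  IsDot : Fin n → Set
  IsDot k = ∃₂ λ i j → DotAt k i j

  Next : Fin n → Fin n → Set
  Next k k′ = (∃ λ j → WhiteDot k j × k′ ≡ j)
            ⊎ (∃ λ i → BlackDot i k × ¬ Unrestricted i × k′ ≡ i)

  Terminal : Fin n → Set
  Terminal k = ∃ λ i → BlackDot i k × Unrestricted i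

  data AltPath : Fin n → List (Fin n) → Set where
    stop : ∀ {k} → Terminal k → AltPath k [ k ]
    next : ∀ {k k′ ps} → Next k k′ → AltPath k′ ps → AltPath k (k ∷ ps)

  Contains : List (Fin n) → List (Fin n) → Set
  Contains P Q = ∃ λ L → P ≡ L ++ Q

  EndsWith : List (Fin n) → Fin n → Set
  EndsWith P d = ∃ λ L → P ≡ L ++ [ d ]

  deleteCommon : List (Fin n) → List (Fin n) → List (Fin n)
  deleteCommon P Q = filter (λ d → ¬? (d ∈? Q)) P

  DotBelowOrRight : Fin n → Fin n → Set
  DotBelowOrRight d e = ∃₂ λ i j → ∃₂ λ i′ j′ →
    DotAt d i j × DotAt e i′ j′ × (i′ < i ⊎ (i ≡ i′ × j < j′))

  -- P > Q (only defined when neither contains the other); covers both the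
  -- "no common dot" case (nothing deleted) and the "common dot" case.
  PathGt : List (Fin n) → List (Fin n) → Set
  PathGt P Q = ¬ Contains P Q × ¬ Contains Q P ×
    ∃₂ λ d e → EndsWith (deleteCommon P Q) d × EndsWith (deleteCommon Q P) e
               × DotBelowOrRight d e

  Inversion : Fin n → Fin n → Set
  Inversion j k = IsCol j × j < k × IsDot k ×
    ∃₂ λ P Q → AltPath j P × AltPath k Q × k ∉ P × PathGt P Q

  InvZero : Set
  InvZero = ∀ j k → ¬ Inversion j k

  LBell : Set
  LBell = ∀ i j → BlackDot i j → ∀ j′ → j < j′ → IsCol j′ → Zero i j′

-- Alternating paths move weakly up and to the left, so two of them can be compared by walking
-- along both at once.  Call a column bell if its topmost 1 is the leftmost 1 of its row.  If all
-- columns from c₀ leftwards are bell, take an upper path starting at a black dot (r , c) with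
-- c₀ ≤ c and a lower path starting strictly beneath it.  Then the lower path either runs into the
-- upper one, or the two separate and the upper path ends strictly higher; either way the upper
-- path is not the greater one.  Bellness enters when the lower path is at a black dot (b , y) left
-- of c and the upper path cannot move past column y: then (r , y) is a 0 which is not restricted,
-- so the topmost 1 of column y, at row b, lies below row r.
-- With c₀ = j this excludes every inversion (j , k) of an L-Bell tableau.  Conversely, let c be
-- the leftmost column that is not bell, with topmost 1 at (i , c) and another 1 at (i , j), j left
-- of c.  The black dot of column j lies in a row r ≤ i.  If r = i both paths P_c and P_j continue
-- through the same white dot of row i; if r < i the walk with c₀ = j shows that P_c, which
-- continues from row i, ends lower than P_j after they separate.  Either way (c , j) is an inversion.

module Submission where

open import Defs
open import Data.Bool using (Bool; true; false)
import Data.Bool as Bool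
open import Data.Empty using (⊥; ⊥-elim)
open import Data.Fin using (Fin; _≟_; _<_; _≤_; _>_)
open import Data.Fin.Induction using (<-wellFounded; >-wellFounded)
open import Data.Fin.Properties using (any?; all?; _<?_; <-cmp; <-trans; <⇒≢)
open import Data.List using (List; []; _∷_; _++_; [_]; filter)
open import Data.List.Membership.Propositional using (_∈_; _∉_)
open import Data.List.Membership.Propositional.Properties using (∈-++⁺ʳ; ∈-++⁻)
import Data.List.Membership.DecPropositional as DecMembership
import Data.List.Properties as List
open import Data.List.Relation.Unary.All using (tabulate)
open import Data.List.Relation.Unary.Any using (here; there)
open import Data.Nat using (ℕ)
import Data.Nat as ℕ
import Data.Nat.Properties as ℕ
open import Data.Product using (_×_; _,_; ∃; ∃₂; proj₁; proj₂)
open import Data.Sum using (_⊎_; inj₁; inj₂)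
open import Function.Bundles using (_⇔_; mk⇔)
open import Induction.WellFounded using (Acc; acc)
open import Relation.Binary.Definitions using (tri<; tri≈; tri>)
open import Relation.Binary.PropositionalEquality
  using (_≡_; _≢_; ≢-sym; refl; sym; trans; cong; subst; module ≡-Reasoning)
open import Relation.Nullary using (¬_; Dec; yes; no; ¬?)
open import Relation.Nullary.Decidable using (_×-dec_)
open import Relation.Unary using (Pred; Decidable)

∃-least : ∀ {n p} {P : Pred (Fin n) p} → Decidable P → ∀ {i} → P i →
          ∃ λ m → P m × (∀ k → k < m → ¬ P k)
∃-least {P = P} P? {i} = go (<-wellFounded i)
  where
  go : ∀ {i} → Acc _<_ i → P i → ∃ λ m → P m × (∀ k → k < m → ¬ P k)
  go {i} (acc below) pi with any? (λ k → k <? i ×-dec P? k)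
  ... | yes (k , k<i , pk) = go (below k<i) pk
  ... | no none = i , pi , λ k k<i pk → none (k , k<i , pk)

∉-∷ : ∀ {a} {A : Set a} {z x : A} {xs} → z ≢ x → z ∉ xs → z ∉ x ∷ xs
∉-∷ z≢x z∉xs (here z≡x) = z≢x z≡x
∉-∷ z≢x z∉xs (there z∈xs) = z∉xs z∈xs

∈-split : ∀ {a} {A : Set a} {d : A} {xs} ys zs → xs ≡ ys ++ d ∷ zs → d ∈ xs
∈-split ys zs refl = ∈-++⁺ʳ ys (here refl)

∈-split-suffix : ∀ {a} {A : Set a} {d z : A} {xs} ys zs → xs ≡ ys ++ d ∷ zs → z ∈ zs → z ∈ xs
∈-split-suffix ys zs refl z∈zs = ∈-++⁺ʳ ys (there z∈zs)

module PermutationTableau {n : ℕ} (T : Filling n) (tab : IsPermTableau T) where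
  open Filling T

  private
    variable
      i j k ℓ r c b e q w x y x′ y′ : Fin n
      viaWhite : Bool
      P Q L U Uf : List (Fin n)

  One⇒¬Zero : One T i j → ¬ Zero T i j
  One⇒¬Zero one zero with () ← trans (sym one) zero

  row⇒¬col : IsRow T i → ¬ IsCol T i
  row⇒¬col row col with () ← trans (sym row) col

  black-row : BlackDot T r c → IsRow T r
  black-row ((row , _ , _) , _) = row

  black-col : BlackDot T r c → IsCol T c
  black-col ((_ , col , _) , _) = col

  black-one : BlackDot T r c → One T r c
  black-one (_ , one , _) = one

  black-row<col : BlackDot T r c → r < c
  black-row<col ((_ , _ , r<c) , _) = r<c

  white-row : WhiteDot T r w → IsRow T r
  white-row (((row , _ , _) , _) , _) = row

  white-col : WhiteDot T r w → IsCol T w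
  white-col (((_ , col , _) , _) , _) = col

  white-row<col : WhiteDot T r w → r < w
  white-row<col (((_ , _ , r<w) , _) , _) = r<w

  black-dotAt : BlackDot T r c → DotAt T c r c
  black-dotAt bd = inj₁ (black-col bd , refl , bd)

  white-dotAt : WhiteDot T r w → DotAt T r r w
  white-dotAt wd = inj₂ (white-row wd , refl , wd)

  blackDot-unique : BlackDot T r c → BlackDot T b c → r ≡ b
  blackDot-unique {r} {b = b} (cell , one , above) (cell′ , one′ , above′) with <-cmp r b
  ... | tri< r<b _ _ = ⊥-elim (One⇒¬Zero one (above′ r r<b (proj₁ cell)))
  ... | tri≈ _ r≡b _ = r≡b
  ... | tri> _ _ b<r = ⊥-elim (One⇒¬Zero one′ (above b b<r (proj₁ cell′)))

  whiteDot-unique : WhiteDot T r w → WhiteDot T r c → w ≡ c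
  whiteDot-unique {w = w} {c} (rz , rightmost) (rz′ , rightmost′) with <-cmp w c
  ... | tri< w<c _ _ = ⊥-elim (rightmost′ w w<c rz)
  ... | tri≈ _ w≡c _ = w≡c
  ... | tri> _ _ c<w = ⊥-elim (rightmost c c<w rz′)

  dotAt-unique : DotAt T k x y → DotAt T k x′ y′ → x ≡ x′ × y ≡ y′
  dotAt-unique (inj₁ (_ , refl , bd)) (inj₁ (_ , refl , bd′)) = blackDot-unique bd bd′ , refl
  dotAt-unique (inj₁ (col , _ , _)) (inj₂ (row , _ , _)) = ⊥-elim (row⇒¬col row col)
  dotAt-unique (inj₂ (row , _ , _)) (inj₁ (col , _ , _)) = ⊥-elim (row⇒¬col row col)
  dotAt-unique (inj₂ (_ , refl , wd)) (inj₂ (_ , refl , wd′)) = refl , whiteDot-unique wd wd′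

  black-above-white : WhiteDot T x y → BlackDot T b y → b < x
  black-above-white {x} {b = b} ((_ , _ , (i , i<x , row , one)) , _) (_ , _ , above)
    with b <? x
  ... | yes b<x = b<x
  ... | no b≮x = ⊥-elim (One⇒¬Zero one (above i (ℕ.<-≤-trans i<x (ℕ.≮⇒≥ b≮x)) row))

  -- A 1 right of the white dot would make the white dot a 0 with a 1 above and a 1 to its left.
  one-left-of-white : WhiteDot T r w → One T r c → IsCol T c → c < w
  one-left-of-white {w = w} {c} ((cell , zero , oneAbove) , _) one col with <-cmp c w
  ... | tri< c<w _ _ = c<w
  ... | tri≈ _ refl _ = ⊥-elim (One⇒¬Zero one zero)
  ... | tri> _ _ w<c = ⊥-elim (proj₂ tab _ _ cell zero (oneAbove , (c , w<c , col , one)))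

  black-right-of-white : BlackDot T r c → WhiteDot T r w → c < w
  black-right-of-white bd wd = one-left-of-white wd (black-one bd) (black-col bd)

  altPath-black : IsCol T c → AltPath T c L → ∃ λ r → BlackDot T r c
  altPath-black col (stop (r , bd , _)) = r , bd
  altPath-black col (next (inj₁ (_ , wd , _)) _) = ⊥-elim (row⇒¬col (white-row wd) col)
  altPath-black col (next (inj₂ (r , bd , _ , _)) _) = r , bd

  altPath-white : IsRow T r → AltPath T r L → ∃ λ w → WhiteDot T r w
  altPath-white row (stop (_ , bd , _)) = ⊥-elim (row⇒¬col row (black-col bd))
  altPath-white row (next (inj₁ (w , wd , _)) _) = w , wd
  altPath-white row (next (inj₂ (_ , bd , _ , _)) _) = ⊥-elim (row⇒¬col row (black-col bd))

  altPath-head : AltPath T k L → k ∈ L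
  altPath-head (stop _) = here refl
  altPath-head (next _ _) = here refl

  altPath-last : AltPath T k L → ∃ λ d → EndsWith T L d
  altPath-last {k} (stop _) = k , [] , refl
  altPath-last {k} (next _ rest) with altPath-last rest
  ... | d , L₀ , refl = d , k ∷ L₀ , refl

  next-unique : Next T k x → Next T k y → x ≡ y
  next-unique (inj₁ (_ , wd , refl)) (inj₁ (_ , wd′ , refl)) = whiteDot-unique wd wd′
  next-unique (inj₁ (_ , wd , _)) (inj₂ (_ , bd , _ , _)) = ⊥-elim (row⇒¬col (white-row wd) (black-col bd))
  next-unique (inj₂ (_ , bd , _ , _)) (inj₁ (_ , wd , _)) = ⊥-elim (row⇒¬col (white-row wd) (black-col bd))
  next-unique (inj₂ (_ , bd , _ , refl)) (inj₂ (_ , bd′ , _ , refl)) = blackDot-unique bd bd′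

  terminal⇒¬next : Terminal T k → ¬ Next T k x
  terminal⇒¬next (_ , bd , _) (inj₁ (_ , wd , _)) = row⇒¬col (white-row wd) (black-col bd)
  terminal⇒¬next (_ , bd , un) (inj₂ (_ , bd′ , restricted , _)) =
    restricted (subst (Unrestricted T) (blackDot-unique bd bd′) un)

  altPath-unique : AltPath T k P → AltPath T k Q → P ≡ Q
  altPath-unique (stop _) (stop _) = refl
  altPath-unique (stop t) (next nx _) = ⊥-elim (terminal⇒¬next t nx)
  altPath-unique (next nx _) (stop t) = ⊥-elim (terminal⇒¬next t nx)
  altPath-unique (next nx p) (next nx′ q) with refl ← next-unique nx nx′ = cong (_ ∷_) (altPath-unique p q)

  next-above-left : Next T k ℓ → AltPath T ℓ L → DotAt T k x y →
                    ∃₂ λ x′ y′ → DotAt T ℓ x′ y′ × x′ ≤ x × y ≤ y′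
  next-above-left (inj₁ (w , wd , refl)) rest at with refl , refl ← dotAt-unique at (white-dotAt wd)
    with b , bd ← altPath-black (white-col wd) rest =
    b , w , black-dotAt bd , ℕ.<⇒≤ (black-above-white wd bd) , ℕ.≤-refl
  next-above-left (inj₂ (r , bd , _ , refl)) rest at with refl , refl ← dotAt-unique at (black-dotAt bd)
    with w , wd ← altPath-white (black-row bd) rest =
    r , w , white-dotAt wd , ℕ.≤-refl , ℕ.<⇒≤ (black-right-of-white bd wd)

  altPath-above-left : AltPath T k L → DotAt T k x y → ∀ {d} → d ∈ L →
                       ∃₂ λ x′ y′ → DotAt T d x′ y′ × x′ ≤ x × y ≤ y′
  altPath-above-left {x = x} {y} (stop _) at (here refl) = x , y , at , ℕ.≤-refl , ℕ.≤-refl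
  altPath-above-left {x = x} {y} (next _ _) at (here refl) = x , y , at , ℕ.≤-refl , ℕ.≤-refl
  altPath-above-left (next nx rest) at (there d∈) with _ , _ , at′ , x′≤x , y≤y′ ← next-above-left nx rest at
    with _ , _ , atd , xd≤x′ , y′≤yd ← altPath-above-left rest at′ d∈ =
    _ , _ , atd , ℕ.≤-trans xd≤x′ x′≤x , ℕ.≤-trans y≤y′ y′≤yd

  altPath-bounds : AltPath T k L → DotAt T k x y → ∀ {d} → d ∈ L → DotAt T d x′ y′ → x′ ≤ x × y ≤ y′
  altPath-bounds path at d∈ atd with _ , _ , atd′ , bounds ← altPath-above-left path at d∈
    with refl , refl ← dotAt-unique atd atd′ = bounds

  altPath-∉-below : AltPath T k L → DotAt T k x y → DotAt T ℓ x′ y′ → x < x′ → ℓ ∉ L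
  altPath-∉-below path at atℓ x<x′ ℓ∈L = ℕ.<⇒≱ x<x′ (proj₁ (altPath-bounds path at ℓ∈L atℓ))

  altPath-∉-right : AltPath T k L → DotAt T k x y → DotAt T ℓ x′ y′ → y′ < y → ℓ ∉ L
  altPath-∉-right path at atℓ y′<y ℓ∈L = ℕ.<⇒≱ y′<y (proj₂ (altPath-bounds path at ℓ∈L atℓ))

  isRow? : ∀ i → Dec (IsRow T i)
  isRow? i with step i
  ... | V = yes refl
  ... | H = no λ ()

  isCol? : ∀ i → Dec (IsCol T i)
  isCol? i with step i
  ... | H = yes refl
  ... | V = no λ ()

  cell? : ∀ i j → Dec (Cell T i j)
  cell? i j = isRow? i ×-dec isCol? j ×-dec i <? j

  one? : ∀ i j → Dec (One T i j)
  one? i j = fill i j Bool.≟ true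

  restrictedZero? : ∀ i j → Dec (RestrictedZero T i j)
  restrictedZero? i j =
    cell? i j ×-dec fill i j Bool.≟ false ×-dec any? (λ i′ → i′ <? i ×-dec isRow? i′ ×-dec one? i′ j)

  unrestricted? : ∀ i → Dec (Unrestricted T i)
  unrestricted? i = isRow? i ×-dec all? (λ j → ¬? (restrictedZero? i j))

  blackDot-exists : IsCol T c → ∃ λ r → BlackDot T r c
  blackDot-exists {c} col with ∃-least (λ k → cell? k c ×-dec one? k c) (proj₂ (proj₁ tab c col))
  ... | r , (cell , one) , least = r , cell , one , zeroAbove
    where
    zeroAbove : ∀ i → i < r → IsRow T i → Zero T i c
    zeroAbove i i<r row with fill i c in eq
    ... | false = refl
    ... | true = ⊥-elim (least i i<r ((row , col , <-trans i<r (proj₂ (proj₂ cell))) , eq))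

  whiteDot-exists : IsRow T r → ¬ Unrestricted T r → ∃ λ w → WhiteDot T r w
  whiteDot-exists {r} row restricted with any? (restrictedZero? r)
  ... | no none = ⊥-elim (restricted (row , λ j rz → none (j , rz)))
  ... | yes (_ , rz) = ∃-least (restrictedZero? r) rz

  altPath-from-black : BlackDot T r c → ∃ (AltPath T c)
  altPath-from-black bd = go (>-wellFounded _) bd
    where
    go : Acc _>_ c → BlackDot T r c → ∃ (AltPath T c)
    go {c} {r} (acc left) bd with unrestricted? r
    ... | yes un = _ , stop (r , bd , un)
    ... | no restricted with w , wd ← whiteDot-exists (black-row bd) restricted
      with _ , bd′ ← blackDot-exists (white-col wd)
      with L , path ← go (left (black-right-of-white bd wd)) bd′ =
      c ∷ r ∷ L , next (inj₂ (r , bd , restricted , refl)) (next (inj₁ (w , wd , refl)) path)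

  open DecMembership (_≟_ {n}) using (_∈?_)

  record Fork (P Q : List (Fin n)) (d e : Fin n) : Set where
    constructor fork
    field
      P₀ Q₀ S : List (Fin n)
      P≡ : P ≡ P₀ ++ d ∷ S
      Q≡ : Q ≡ Q₀ ++ e ∷ S
      d∉Q : d ∉ Q
      e∉P : e ∉ P

  deleteCommon-ends : ∀ {d} P₀ S → P ≡ P₀ ++ d ∷ S → d ∉ Q → (∀ {z} → z ∈ S → z ∈ Q) →
                      EndsWith T (deleteCommon T P Q) d
  deleteCommon-ends {Q = Q} {d} P₀ S refl d∉Q S⊆Q = filter keep P₀ , (begin
    filter keep (P₀ ++ d ∷ S)             ≡⟨ List.filter-++ keep P₀ (d ∷ S) ⟩
    filter keep P₀ ++ filter keep (d ∷ S) ≡⟨ cong (filter keep P₀ ++_) (List.filter-accept keep d∉Q) ⟩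
    filter keep P₀ ++ d ∷ filter keep S   ≡⟨ cong (λ S′ → filter keep P₀ ++ d ∷ S′) S-deleted ⟩
    filter keep P₀ ++ [ d ]               ∎)
    where
    open ≡-Reasoning
    keep = λ (z : Fin n) → ¬? (z ∈? Q)
    S-deleted : filter keep S ≡ []
    S-deleted = List.filter-none keep (tabulate λ z∈S z∉Q → z∉Q (S⊆Q z∈S))

  fork-ends : ∀ {d e} → Fork P Q d e → EndsWith T (deleteCommon T P Q) d × EndsWith T (deleteCommon T Q P) e
  fork-ends (fork P₀ Q₀ S P≡ Q≡ d∉Q e∉P) =
    deleteCommon-ends P₀ S P≡ d∉Q (∈-split-suffix Q₀ S Q≡) ,
    deleteCommon-ends Q₀ S Q≡ e∉P (∈-split-suffix P₀ S P≡)

  fork-swap : ∀ {d e} → Fork P Q d e → Fork Q P e d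
  fork-swap (fork P₀ Q₀ S P≡ Q≡ d∉Q e∉P) = fork Q₀ P₀ S Q≡ P≡ e∉P d∉Q

  fork⇒PathGt : ∀ {d e} → Fork P Q d e → DotBelowOrRight T d e → PathGt T P Q
  fork⇒PathGt {d = d} {e} f@(fork P₀ Q₀ S P≡ Q≡ d∉Q e∉P) below =
    (λ { (L , refl) → e∉P (∈-++⁺ʳ L (∈-split Q₀ S Q≡)) }) ,
    (λ { (L , refl) → d∉Q (∈-++⁺ʳ L (∈-split P₀ S P≡)) }) ,
    d , e , proj₁ (fork-ends f) , proj₂ (fork-ends f) , below

  Higher : Fin n → Fin n → Set
  Higher d e = ∃₂ λ xd yd → ∃₂ λ xe ye → DotAt T d xd yd × DotAt T e xe ye × xd < xe

  higher⇒belowOrRight : ∀ {d e} → Higher d e → DotBelowOrRight T e d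
  higher⇒belowOrRight (xd , yd , xe , ye , atd , ate , xd<xe) = xe , ye , xd , yd , ate , atd , inj₁ xd<xe

  endsWith-unique : ∀ {d e} → EndsWith T L d → EndsWith T L e → d ≡ e
  endsWith-unique (L₀ , refl) (L₁ , eq) = List.∷ʳ-injectiveʳ L₀ L₁ eq

  higherFork⇒¬PathGt : ∀ {d e} → Fork P Q d e → Higher d e → ¬ PathGt T P Q
  higherFork⇒¬PathGt f (_ , _ , _ , _ , atd , ate , xd<xe)
                       (_ , _ , _ , _ , endP , endQ , _ , _ , _ , _ , atd′ , ate′ , below)
    with refl ← endsWith-unique endP (proj₁ (fork-ends f)) | refl ← endsWith-unique endQ (proj₂ (fork-ends f))
    with refl , refl ← dotAt-unique atd atd′ | refl , refl ← dotAt-unique ate ate′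
    with below
  ... | inj₁ xe<xd = ℕ.<-asym xd<xe xe<xd
  ... | inj₂ (refl , _) = ℕ.<-irrefl refl xd<xe

  fork-∷ʳ : ∀ {d e z} → z ∉ P → Fork P Q d e → Fork P (z ∷ Q) d e
  fork-∷ʳ z∉P (fork P₀ Q₀ S P≡ refl d∉Q e∉P) = fork P₀ (_ ∷ Q₀) S P≡ refl d∉zQ e∉P
    where
    d∉zQ : _ ∉ _ ∷ _
    d∉zQ (here refl) = z∉P (∈-split P₀ S P≡)
    d∉zQ (there d∈Q) = d∉Q d∈Q

  fork-∷ˡ : ∀ {d e z} → z ∉ Q → Fork P Q d e → Fork (z ∷ P) Q d e
  fork-∷ˡ z∉Q f = fork-swap (fork-∷ʳ z∉Q (fork-swap f))

  BellColumn : Fin n → Set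
  BellColumn c = ∀ r → BlackDot T r c → ∀ j → c < j → IsCol T j → Zero T r j

  bell-black-above : BellColumn c → BlackDot T r c → c < y → BlackDot T b y → ¬ RestrictedZero T r y → r < b
  bell-black-above {r = r} {b = b} bell bd c<y bdy notRestricted with bell _ bd _ c<y (black-col bdy) | <-cmp b r
  ... | zero | tri< b<r _ _ = ⊥-elim (notRestricted ((black-row bd , black-col bdy , <-trans (black-row<col bd) c<y) ,
                                                       zero , (b , b<r , black-row bdy , black-one bdy)))
  ... | zero | tri≈ _ refl _ = ⊥-elim (One⇒¬Zero (black-one bdy) zero)
  ... | _    | tri> _ _ r<b = r<b

  -- The upper path of the walk: the alternating path U from the black dot (r , c), possibly
  -- preceded by a white dot (e , c) of a lower row.
  data Entry (c r : Fin n) : Bool → Fin n → List (Fin n) → List (Fin n) → Set where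
    at-black  : ∀ {U} → Entry c r false r U U
    via-white : ∀ {e U} → WhiteDot T e c → Entry c r true e U (e ∷ U)

  entry-row : BlackDot T r c → Entry c r viaWhite e U Uf → r ≤ e
  entry-row bd at-black = ℕ.≤-refl
  entry-row bd (via-white wd) = ℕ.<⇒≤ (black-above-white wd bd)

  entry-split : Entry c r viaWhite e U Uf → ∃ λ pre → Uf ≡ pre ++ U × (∀ {z} → z ∈ pre → DotAt T z e c)
  entry-split at-black = [] , refl , λ ()
  entry-split (via-white wd) = [ _ ] , refl , λ { (here refl) → white-dotAt wd }

  -- (x , y) is strictly below the upper path entering column c at row e: every dot of that
  -- path left of column c lies in a row ≤ r.
  Beneath : (c r e x y : Fin n) → Set
  Beneath c r e x y = (c ≡ y × e < x) ⊎ (c < y × r < x)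

  beneath-≤ : c ≤ y → r < x → e < x → Beneath c r e x y
  beneath-≤ {c} {y} c≤y r<x e<x with <-cmp c y
  ... | tri< c<y _ _ = inj₂ (c<y , r<x)
  ... | tri≈ _ c≡y _ = inj₁ (c≡y , e<x)
  ... | tri> _ _ y<c = ⊥-elim (ℕ.<⇒≱ y<c c≤y)

  beneath-∉ : BlackDot T r c → AltPath T c U → Entry c r viaWhite e U Uf → Beneath c r e x y →
              DotAt T ℓ x y → ℓ ∉ Uf
  beneath-∉ bd pathU entry beneath at ℓ∈Uf with pre , refl , pre-at ← entry-split entry
    with ∈-++⁻ pre ℓ∈Uf | beneath
  ... | inj₁ ℓ∈pre | inj₁ (_ , e<x) with refl , refl ← dotAt-unique at (pre-at ℓ∈pre) = ℕ.<-irrefl refl e<x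
  ... | inj₁ ℓ∈pre | inj₂ (c<y , _) with refl , refl ← dotAt-unique at (pre-at ℓ∈pre) = ℕ.<-irrefl refl c<y
  ... | inj₂ ℓ∈U | inj₁ (_ , e<x) =
    ℕ.<⇒≱ e<x (ℕ.≤-trans (proj₁ (altPath-bounds pathU (black-dotAt bd) ℓ∈U at)) (entry-row bd entry))
  ... | inj₂ ℓ∈U | inj₂ (_ , r<x) = ℕ.<⇒≱ r<x (proj₁ (altPath-bounds pathU (black-dotAt bd) ℓ∈U at))

  -- Either outcome rules out U > L; L can only run into all of U when U starts at its black dot.
  Settled : Bool → List (Fin n) → List (Fin n) → Set
  Settled viaWhite U L = (∃₂ λ d e → Fork U L d e × Higher d e) ⊎ (viaWhite ≡ false × Contains T L U)

  -- The lower path has reached the black dot of column y, and that dot lies on the upper path.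
  Joins : Bool → Fin n → Fin n → List (Fin n) → List (Fin n) → Set
  Joins viaWhite x y U L =
    (∃₂ λ U₀ p → U ≡ U₀ ++ p ∷ L × WhiteDot T p y × p < x) ⊎ (viaWhite ≡ false × U ≡ L)

  settled⇒¬PathGt : Settled viaWhite P Q → ¬ PathGt T P Q
  settled⇒¬PathGt (inj₁ (_ , _ , f , higher)) = higherFork⇒¬PathGt f higher
  settled⇒¬PathGt (inj₂ (_ , Q⊇P)) (_ , notQ⊇P , _) = notQ⊇P Q⊇P

  settled-∷ : ∀ {z} → z ∉ Uf → Settled viaWhite Uf L → Settled viaWhite Uf (z ∷ L)
  settled-∷ z∉Uf (inj₁ (d , e , f , higher)) = inj₁ (d , e , fork-∷ʳ z∉Uf f , higher)
  settled-∷ z∉Uf (inj₂ (viaWhite≡ , L₀ , refl)) = inj₂ (viaWhite≡ , _ ∷ L₀ , refl)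

  settled-∷-white : q ∉ Uf → WhiteDot T q y → BlackDot T b y → AltPath T y L →
                    Settled viaWhite Uf L ⊎ Joins viaWhite q y Uf L → Settled viaWhite Uf (q ∷ L)
  settled-∷-white q∉Uf wd bdy pathL (inj₁ settled) = settled-∷ q∉Uf settled
  settled-∷-white {q = q} {y = y} {L = L} q∉Uf wd bdy pathL (inj₂ (inj₁ (U₀ , p , Uf≡ , wdp , p<q))) =
    inj₁ (p , q , fork U₀ [] L Uf≡ refl p∉qL q∉Uf , p , y , q , y , white-dotAt wdp , white-dotAt wd , p<q)
    where
    p∉qL : p ∉ q ∷ L
    p∉qL = ∉-∷ (<⇒≢ p<q) (altPath-∉-below pathL (black-dotAt bdy) (white-dotAt wdp) (black-above-white wdp bdy))
  settled-∷-white q∉Uf wd bdy pathL (inj₂ (inj₂ (viaWhite≡ , refl))) = inj₂ (viaWhite≡ , [ _ ] , refl)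

  entry-joins : Entry c r viaWhite e U Uf → e < x → Joins viaWhite x c Uf U
  entry-joins at-black _ = inj₂ (refl , refl)
  entry-joins (via-white wd) e<x = inj₁ ([] , _ , refl , wd , e<x)

  prepend-≡ : ∀ {c d : Fin n} pre {U₀ S} → U ≡ U₀ ++ d ∷ S → pre ++ c ∷ U ≡ (pre ++ c ∷ U₀) ++ d ∷ S
  prepend-≡ {c = c} pre {U₀} refl = sym (List.++-assoc pre (c ∷ U₀) _)

  prepend-entry : Entry c r viaWhite e (c ∷ r ∷ U) Uf → c < y → BlackDot T r c → BlackDot T b y → AltPath T y L →
                  Settled true (r ∷ U) L ⊎ Joins true x y (r ∷ U) L → Settled viaWhite Uf L ⊎ Joins viaWhite x y Uf L
  prepend-entry {c = c} {y = y} entry c<y bd bdy pathL (inj₁ (inj₁ (d , e , fork U₀ L₀ S U≡ L≡ d∉L e∉U , higher)))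
    with pre , refl , pre-at ← entry-split entry =
    inj₁ (inj₁ (d , e , fork (pre ++ c ∷ U₀) L₀ S (prepend-≡ pre U≡) L≡ d∉L e∉Uf , higher))
    where
    left-of-y : ∀ {x′ y′} → DotAt T e x′ y′ → y ≤ y′
    left-of-y at = proj₂ (altPath-bounds pathL (black-dotAt bdy) (∈-split L₀ S L≡) at)
    e∉Uf : e ∉ pre ++ c ∷ _
    e∉Uf e∈Uf with ∈-++⁻ pre e∈Uf
    ... | inj₁ e∈pre = ℕ.<⇒≱ c<y (left-of-y (pre-at e∈pre))
    ... | inj₂ (here refl) = ℕ.<⇒≱ c<y (left-of-y (black-dotAt bd))
    ... | inj₂ (there e∈U) = e∉U e∈U
  prepend-entry {c = c} entry c<y bd bdy pathL (inj₂ (inj₁ (U₀ , p , U≡ , wdp , p<x)))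
    with pre , refl , _ ← entry-split entry =
    inj₂ (inj₁ (pre ++ c ∷ U₀ , p , prepend-≡ pre U≡ , wdp , p<x))
  prepend-entry entry c<y bd bdy pathL (inj₁ (inj₂ (() , _)))
  prepend-entry entry c<y bd bdy pathL (inj₂ (inj₂ (() , _)))

  -- The two paths are walked simultaneously, always advancing the one whose current dot is
  -- further right.
  module Settle (c₀ : Fin n) (bell : ∀ {c} → c₀ ≤ c → BellColumn c) where
    mutual
      settle-white : c₀ ≤ c → BlackDot T r c → AltPath T c U → Entry c r viaWhite e U Uf →
                     WhiteDot T q y → AltPath T q L → Beneath c r e q y → Settled viaWhite Uf L
      settle-white c₀≤c bd pathU entry wd (stop (_ , bd′ , _)) beneath =
        ⊥-elim (row⇒¬col (white-row wd) (black-col bd′))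
      settle-white c₀≤c bd pathU entry wd (next (inj₂ (_ , bd′ , _ , _)) _) beneath =
        ⊥-elim (row⇒¬col (white-row wd) (black-col bd′))
      settle-white c₀≤c bd pathU entry wd (next (inj₁ (_ , wd′ , refl)) pathL) beneath
        with refl ← whiteDot-unique wd wd′ with _ , bdy ← altPath-black (white-col wd) pathL =
        settled-∷-white (beneath-∉ bd pathU entry beneath (white-dotAt wd)) wd bdy pathL
          (settle-black c₀≤c bd pathU entry bdy pathL beneath)

      settle-black : c₀ ≤ c → BlackDot T r c → AltPath T c U → Entry c r viaWhite e U Uf →
                     BlackDot T b y → AltPath T y L → Beneath c r e x y → Settled viaWhite Uf L ⊎ Joins viaWhite x y Uf L
      settle-black c₀≤c bd pathU entry bdy pathL (inj₁ (refl , e<x)) =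
        inj₂ (subst (Joins _ _ _ _) (altPath-unique pathU pathL) (entry-joins entry e<x))
      settle-black c₀≤c bd pathU entry bdy pathL (inj₂ (c<y , r<x)) =
        settle-black-left c₀≤c bd pathU entry bdy pathL c<y r<x

      settle-black-left : c₀ ≤ c → BlackDot T r c → AltPath T c U → Entry c r viaWhite e U Uf →
                          BlackDot T b y → AltPath T y L → c < y → r < x → Settled viaWhite Uf L ⊎ Joins viaWhite x y Uf L
      settle-black-left c₀≤c bd pathU@(stop (_ , bd′ , un)) entry bdy pathL c<y r<x
        with refl ← blackDot-unique bd bd′ =
        inj₁ (settle-below c₀≤c bd pathU entry bdy pathL c<y
               (bell-black-above (bell c₀≤c) bd c<y bdy (proj₂ un _)))
      settle-black-left c₀≤c bd (next (inj₁ (_ , wd , _)) _) entry bdy pathL c<y r<x =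
        ⊥-elim (row⇒¬col (white-row wd) (black-col bd))
      settle-black-left c₀≤c bd (next (inj₂ (_ , bd′ , _ , refl)) (stop (_ , bd″ , _))) entry bdy pathL c<y r<x =
        ⊥-elim (row⇒¬col (black-row bd′) (black-col bd″))
      settle-black-left c₀≤c bd (next (inj₂ (_ , bd′ , _ , refl)) (next (inj₂ (_ , bd″ , _ , _)) _))
                        entry bdy pathL c<y r<x =
        ⊥-elim (row⇒¬col (black-row bd′) (black-col bd″))
      settle-black-left {y = y} c₀≤c bd pathU@(next (inj₂ (_ , bd′ , _ , refl)) (next (inj₁ (w , wd , refl)) pathU₂))
                        entry bdy pathL c<y r<x
        with refl ← blackDot-unique bd bd′ | _ , bdw ← altPath-black (white-col wd) pathU₂ | y <? w
      ... | yes y<w = inj₁ (settle-below c₀≤c bd pathU entry bdy pathL c<y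
                             (bell-black-above (bell c₀≤c) bd c<y bdy (proj₂ wd y y<w)))
      ... | no y≮w = prepend-entry entry c<y bd bdy pathL
                       (settle-black (ℕ.≤-trans c₀≤c (ℕ.<⇒≤ (black-right-of-white bd wd))) bdw pathU₂ (via-white wd)
                          bdy pathL (beneath-≤ (ℕ.≮⇒≥ y≮w) (<-trans (black-above-white wd bdw) r<x) r<x))

      settle-below : c₀ ≤ c → BlackDot T r c → AltPath T c U → Entry c r viaWhite e U Uf →
                     BlackDot T b y → AltPath T y L → c < y → r < b → Settled viaWhite Uf L
      settle-below {y = y} c₀≤c bd pathU entry bdy (stop _) c<y r<b
        with pre , refl , _ ← entry-split entry | d , U₀ , refl ← altPath-last pathU
        with xd , yd , atd , xd≤r , _ ← altPath-above-left pathU (black-dotAt bd) (∈-split U₀ [] refl) =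
        inj₁ (d , y , fork (pre ++ U₀) [] [] (sym (List.++-assoc pre U₀ [ d ])) refl d∉y y∉Uf ,
              xd , yd , _ , y , atd , black-dotAt bdy , ℕ.≤-<-trans xd≤r r<b)
        where
        y∉Uf : y ∉ pre ++ U₀ ++ [ d ]
        y∉Uf = beneath-∉ bd pathU entry (inj₂ (c<y , r<b)) (black-dotAt bdy)
        d∉y : d ∉ [ y ]
        d∉y (here refl) = y∉Uf (∈-++⁺ʳ pre (∈-split U₀ [] refl))
      settle-below c₀≤c bd pathU entry bdy (next (inj₁ (_ , wd , _)) _) c<y r<b =
        ⊥-elim (row⇒¬col (white-row wd) (black-col bdy))
      settle-below c₀≤c bd pathU entry bdy (next (inj₂ (_ , bdy′ , _ , refl)) pathL) c<y r<b
        with refl ← blackDot-unique bdy bdy′ with _ , wd ← altPath-white (black-row bdy) pathL =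
        settled-∷ (beneath-∉ bd pathU entry (inj₂ (c<y , r<b)) (black-dotAt bdy))
          (settle-white c₀≤c bd pathU entry wd pathL (inj₂ (<-trans c<y (black-right-of-white bdy wd) , r<b)))

  bell⇒¬inversion : (∀ {c} → j ≤ c → BellColumn c) → ¬ Inversion T j k
  bell⇒¬inversion {j} bell (col , j<k , (_ , _ , inj₂ (_ , refl , wd)) , P , Q , pathP , pathQ , k∉P , P>Q)
    with _ , bd ← altPath-black col pathP =
    settled⇒¬PathGt (Settle.settle-white j bell ℕ.≤-refl bd pathP at-black wd pathQ
                       (inj₂ (<-trans j<k (white-row<col wd) , <-trans (black-row<col bd) j<k))) P>Q
  bell⇒¬inversion {j} bell (col , j<k , (_ , _ , inj₁ (_ , refl , bdk)) , P , Q , pathP , pathQ , k∉P , P>Q)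
    with _ , bd ← altPath-black col pathP
    with Settle.settle-black j bell ℕ.≤-refl bd pathP at-black bdk pathQ (inj₂ (j<k , <-trans (black-row<col bd) j<k))
  ... | inj₁ settled = settled⇒¬PathGt settled P>Q
  ... | inj₂ (inj₁ (P₀ , _ , refl , _)) = k∉P (∈-++⁺ʳ P₀ (there (altPath-head pathQ)))
  ... | inj₂ (inj₂ (_ , refl)) = k∉P (altPath-head pathQ)

  black-next : BlackDot T r c → Next T c k → k ≡ r
  black-next bd (inj₁ (_ , wd , _)) = ⊥-elim (row⇒¬col (white-row wd) (black-col bd))
  black-next bd (inj₂ (_ , bd′ , _ , refl)) = blackDot-unique bd′ bd

  same-row-tails : BlackDot T r c → BlackDot T r j → AltPath T c P → AltPath T j Q →
                   ∃ λ S → P ≡ c ∷ S × Q ≡ j ∷ S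
  same-row-tails bd bd′ (stop _) (stop _) = [] , refl , refl
  same-row-tails bd bd′ (stop (_ , bd″ , un)) (next nx _) =
    ⊥-elim (terminal⇒¬next (_ , bd′ , subst (Unrestricted T) (blackDot-unique bd″ bd) un) nx)
  same-row-tails bd bd′ (next nx _) (stop (_ , bd″ , un)) =
    ⊥-elim (terminal⇒¬next (_ , bd , subst (Unrestricted T) (blackDot-unique bd″ bd′) un) nx)
  same-row-tails bd bd′ (next nx rest) (next nx′ rest′)
    with refl ← black-next bd nx | refl ← black-next bd′ nx′ = _ , refl , cong (_ ∷_) (altPath-unique rest′ rest)

  black-tail-∉ : ∀ {S} → BlackDot T r c → AltPath T c (c ∷ S) → DotAt T ℓ x y → y ≤ c → ℓ ∉ S
  black-tail-∉ bd (stop _) at y≤c ()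
  black-tail-∉ bd (next (inj₁ (_ , wd , _)) _) = ⊥-elim (row⇒¬col (white-row wd) (black-col bd))
  black-tail-∉ bd (next (inj₂ (_ , bd′ , _ , refl)) rest) at y≤c with refl ← blackDot-unique bd bd′
    with _ , wd ← altPath-white (black-row bd) rest =
    altPath-∉-right rest (white-dotAt wd) at (ℕ.≤-<-trans y≤c (black-right-of-white bd wd))

  same-row-inversion : BlackDot T r c → BlackDot T r j → c < j → Inversion T c j
  same-row-inversion bd bdj c<j with _ , pathP ← altPath-from-black bd | _ , pathQ ← altPath-from-black bdj
    with S , refl , refl ← same-row-tails bd bdj pathP pathQ =
    black-col bd , c<j , (_ , _ , black-dotAt bdj) , _ , _ , pathP , pathQ , j∉P ,
    fork⇒PathGt (fork [] [] S refl refl c∉Q j∉P)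
                (_ , _ , _ , _ , black-dotAt bd , black-dotAt bdj , inj₂ (refl , c<j))
    where
    j∉P = ∉-∷ (≢-sym (<⇒≢ c<j)) (black-tail-∉ bdj pathQ (black-dotAt bdj) ℕ.≤-refl)
    c∉Q = ∉-∷ (<⇒≢ c<j) (black-tail-∉ bdj pathQ (black-dotAt bd) (ℕ.<⇒≤ c<j))

  lower-row-inversion : (∀ {c′} → j ≤ c′ → BellColumn c′) → BlackDot T i c → BlackDot T r j → r < i → c < j →
                        One T i j → Inversion T c j
  lower-row-inversion bell bd bdj r<i c<j one with _ , pathQ ← altPath-from-black bdj | altPath-from-black bd
  ... | _ , pathP@(stop _) with d , Q₀ , refl ← altPath-last pathQ
    with _ , _ , atd , xd≤r , _ ← altPath-above-left pathQ (black-dotAt bdj) (∈-split Q₀ [] refl) =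
    black-col bd , c<j , (_ , _ , black-dotAt bdj) , _ , _ , pathP , pathQ , ∉-∷ (≢-sym (<⇒≢ c<j)) (λ ()) ,
    fork⇒PathGt (fork [] Q₀ [] refl refl c∉Q (∉-∷ (λ { refl → c∉Q (∈-split Q₀ [] refl) }) λ ()))
                (higher⇒belowOrRight (_ , _ , _ , _ , atd , black-dotAt bd , ℕ.≤-<-trans xd≤r r<i))
    where
    c∉Q = altPath-∉-right pathQ (black-dotAt bdj) (black-dotAt bd) c<j
  ... | _ , next (inj₁ (_ , wd , _)) _ = ⊥-elim (row⇒¬col (white-row wd) (black-col bd))
  ... | _ , pathP@(next (inj₂ (_ , bd′ , _ , refl)) pathL) with refl ← blackDot-unique bd bd′
    with _ , wd ← altPath-white (black-row bd) pathL
    with j<w ← one-left-of-white wd one (black-col bdj)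
    with Settle.settle-white _ bell ℕ.≤-refl bdj pathQ at-black wd pathL (inj₂ (j<w , r<i))
  ...   | inj₁ (_ , _ , f , higher) =
    black-col bd , c<j , (_ , _ , black-dotAt bdj) , _ , _ , pathP , pathQ , ∉-∷ (≢-sym (<⇒≢ c<j)) j∉L ,
    fork⇒PathGt (fork-∷ˡ (altPath-∉-right pathQ (black-dotAt bdj) (black-dotAt bd) c<j) (fork-swap f))
                (higher⇒belowOrRight higher)
    where
    j∉L = altPath-∉-right pathL (white-dotAt wd) (black-dotAt bdj) j<w
  ...   | inj₂ (_ , L₀ , refl) =
    ⊥-elim (altPath-∉-right pathL (white-dotAt wd) (black-dotAt bdj) j<w (∈-++⁺ʳ L₀ (altPath-head pathQ)))

  column-inversion : (∀ {c′} → c < c′ → BellColumn c′) → BlackDot T i c → c < j → IsCol T j → One T i j →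
                     Inversion T c j
  column-inversion {i = i} bells bd c<j colj one with r , bdj ← blackDot-exists colj | <-cmp r i
  ... | tri< r<i _ _ = lower-row-inversion (λ j≤c′ → bells (ℕ.<-≤-trans c<j j≤c′)) bd bdj r<i c<j one
  ... | tri≈ _ refl _ = same-row-inversion bd bdj c<j
  ... | tri> _ _ i<r = ⊥-elim (One⇒¬Zero one (proj₂ (proj₂ bdj) i i<r (black-row bd)))

  InvZero⇒LBell : InvZero T → LBell T
  InvZero⇒LBell noInversion r c = bell (>-wellFounded c) r
    where
    bell : ∀ {c} → Acc _>_ c → BellColumn c
    bell {c} (acc left) r bd j c<j colj with fill r j in eq
    ... | false = refl
    ... | true = ⊥-elim (noInversion c j (column-inversion (λ c<c′ → bell (left c<c′)) bd c<j colj eq))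

  LBell⇒InvZero : LBell T → InvZero T
  LBell⇒InvZero lbell j k = bell⇒¬inversion (λ _ r bd → lbell r _ bd)

theorem3p3 : (n : ℕ) (T : Filling n) → IsPermTableau T → (InvZero T ⇔ LBell T)
theorem3p3 n T tab = mk⇔ InvZero⇒LBell LBell⇒InvZero
  where open PermutationTableau T tab
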